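{- Let $G=G_L\oplus G_R$ be a cograph (the disjoint union of cographs $G_L=(V_L,E_L)$ and $G_R=(V_R,E_R)$) with restricted vertex set $\mathcal{R}$, and let $\mathcal{R}_L=\mathcal{R}\cap V_L$, $\mathcal{R}_R=\mathcal{R}\cap V_R$. Let $CMPD_L$ and $CMPD_R$ be canonical matched-paired-dominating sets of $G_L-I(G_L)$ and $G_R-I(G_R)$ w.r.t. $\mathcal{R}_L-I(G_L)$ and $\mathcal{R}_R-I(G_R)$, respectively. Then $I(G)=I(G_L)\cup I(G_R)$ and $CMPD_L\cup CMPD_R$ is a canonical matched-paired-dominating set of $G-I(G)$ w.r.t. $\mathcal{R}-I(G)$.
   Context: All graphs are finite, simple and undirected. A cograph is a graph with no induced path on four vertices; $G_L\oplus G_R=(V_L\cup V_R,E_L\cup E_R)$ with $V_L\cap V_R=\emptyset$. For a graph $H$, $I(H)$ is the set of isolated vertices of $H$ and $H-I(H)$ is $H$ with these deleted. For a graph $G=(V,E)$ without isolated vertices and $\mathcal{R}\subseteq V$: a set $S\subseteq V$ is a paired-dominating set if every vertex of $V-S$ has a neighbor in $S$ and $G[S]$ has a perfect matching. A set $MPD\subseteq E$ is a matched-paired-dominating set if it is a perfect matching of $G[S]$ for some paired-dominating set $S$; $V(MPD)$ is the set of vertices incident to edges of $MPD$. The matched number of $MPD$ is $|V(MPD)\cap\mathcal{R}|$; a maximum matched-paired-dominating set w.r.t. $\mathcal{R}$ maximizes the matched number. A free-paired-edge is an edge of $MPD$ with no endpoint in $\mathcal{R}$. A canonical matched-paired-dominating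 set w.r.t. $\mathcal{R}$ is a maximum one with the least number of free-paired-edges among all maximum ones. -}

module Defs where

open import Data.Nat using (ℕ; zero; suc; _+_; _≤_)
open import Data.Bool using (Bool; true; false; _∧_; _∨_; not; if_then_else_)
open import Data.Fin using (Fin; splitAt; _↑ˡ_; _↑ʳ_)
open import Data.Sum using (_⊎_; inj₁; inj₂)
open import Data.Product using (_×_; _,_; Σ; ∃; ∃-syntax)
open import Data.List using (List; []; _∷_; map; _++_; allFin; concatMap)
open import Data.Bool.ListAction using (all)
open import Data.List.Membership.Propositional using (_∈_; _∉_)
open import Data.List.Relation.Unary.Unique.Propositional using (Unique)
open import Relation.Binary.PropositionalEquality using (_≡_; _≢_; refl; sym)
open import Relation.Nullary using (¬_)

record Graph : Set where
  field
    n      : ℕ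
    Adj    : Fin n → Fin n → Bool
    adjSym : ∀ u v → Adj u v ≡ Adj v u
    adjIrr : ∀ v → Adj v v ≡ false
open Graph public

IsCograph : Graph → Set
IsCograph G = ¬ (Σ (Fin (n G)) λ a → Σ (Fin (n G)) λ b → Σ (Fin (n G)) λ c → Σ (Fin (n G)) λ d →
   (a ≢ b) × (a ≢ c) × (a ≢ d) × (b ≢ c) × (b ≢ d) × (c ≢ d) ×
   (Adj G a b ≡ true) × (Adj G b c ≡ true) × (Adj G c d ≡ true) ×
   (Adj G a c ≡ false) × (Adj G b d ≡ false) × (Adj G a d ≡ false))

-- Disjoint union G_L ⊕ G_R on Fin (nL + nR): left vertices i ↑ˡ nR, right vertices nL ↑ʳ j.
⊕Adj : ∀ {m k} → (Fin m → Fin m → Bool) → (Fin k → Fin k → Bool) → Fin (m + k) → Fin (m + k) → Bool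
⊕Adj {m} AL AR u v with splitAt m u | splitAt m v
... | inj₁ x | inj₁ y = AL x y
... | inj₂ x | inj₂ y = AR x y
... | inj₁ _ | inj₂ _ = false
... | inj₂ _ | inj₁ _ = false

⊕Sym : (GL GR : Graph) → ∀ u v → ⊕Adj (Adj GL) (Adj GR) u v ≡ ⊕Adj (Adj GL) (Adj GR) v u
⊕Sym GL GR u v with splitAt (n GL) u | splitAt (n GL) v
... | inj₁ x | inj₁ y = adjSym GL x y
... | inj₂ x | inj₂ y = adjSym GR x y
... | inj₁ _ | inj₂ _ = refl
... | inj₂ _ | inj₁ _ = refl

⊕Irr : (GL GR : Graph) → ∀ v → ⊕Adj (Adj GL) (Adj GR) v v ≡ false
⊕Irr GL GR v with splitAt (n GL) v
... | inj₁ x = adjIrr GL x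
... | inj₂ x = adjIrr GR x

_⊕_ : Graph → Graph → Graph
GL ⊕ GR = record
  { n = n GL + n GR
  ; Adj = ⊕Adj (Adj GL) (Adj GR)
  ; adjSym = ⊕Sym GL GR
  ; adjIrr = ⊕Irr GL GR
  }

isolated : (G : Graph) → Fin (n G) → Bool
isolated G v = all (λ u → not (Adj G v u)) (allFin (n G))

-- Vertex set of G - I(G) (as a subset of the vertices of G).
nonIsolated : (G : Graph) → Fin (n G) → Bool
nonIsolated G v = not (isolated G v)

Edges : Graph → Set
Edges G = List (Fin (n G) × Fin (n G))

endpoints : {A : Set} → List (A × A) → List A
endpoints = concatMap (λ { (u , v) → u ∷ v ∷ [] })

-- Matched-paired-dominating set of the induced subgraph G[W]:
-- M is a set of edges of G[W], pairwise vertex-disjoint (so M is a perfect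
-- matching of G[V(M)]), and S = V(M) dominates G[W].
IsMPD : (G : Graph) → (W : Fin (n G) → Bool) → Edges G → Set
IsMPD G W M =
  (∀ {u v} → (u , v) ∈ M → (Adj G u v ≡ true) × (W u ≡ true) × (W v ≡ true)) ×
  Unique (endpoints M) ×
  (∀ v → W v ≡ true → v ∉ endpoints M → ∃[ u ] (u ∈ endpoints M × Adj G v u ≡ true))

countTrue : {A : Set} → (A → Bool) → List A → ℕ
countTrue p [] = 0
countTrue p (x ∷ xs) = if p x then suc (countTrue p xs) else countTrue p xs

matchedNumber : (G : Graph) → (Fin (n G) → Bool) → Edges G → ℕ
matchedNumber G R M = countTrue R (endpoints M)

freeEdges : (G : Graph) → (Fin (n G) → Bool) → Edges G → ℕ
freeEdges G R M = countTrue (λ { (u , v) → not (R u ∨ R v) }) M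

IsMaxMPD : (G : Graph) → (W R : Fin (n G) → Bool) → Edges G → Set
IsMaxMPD G W R M = IsMPD G W M × (∀ M' → IsMPD G W M' → matchedNumber G R M' ≤ matchedNumber G R M)

IsCanonicalMPD : (G : Graph) → (W R : Fin (n G) → Bool) → Edges G → Set
IsCanonicalMPD G W R M = IsMaxMPD G W R M × (∀ M' → IsMaxMPD G W R M' → freeEdges G R M ≤ freeEdges G R M')

restrictNI : (G : Graph) → (Fin (n G) → Bool) → Fin (n G) → Bool
restrictNI G R v = R v ∧ nonIsolated G v

liftL : (GL GR : Graph) → Edges GL → Edges (GL ⊕ GR)
liftL GL GR = map (λ { (u , v) → (u ↑ˡ n GR , v ↑ˡ n GR) })

liftR : (GL GR : Graph) → Edges GR → Edges (GL ⊕ GR)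
liftR GL GR = map (λ { (u , v) → (n GL ↑ʳ u , n GL ↑ʳ v) })

-- Every edge of G_L ⊕ G_R lies inside one of the two sides, and a vertex of
-- one side is isolated in G exactly when it is isolated in its side. Hence
-- the matched-paired-dominating sets of G - I(G) are, up to reordering, the
-- unions of matched-paired-dominating sets of the two sides, and matched
-- number and number of free-paired-edges are additive over this union. A
-- union is maximum iff both parts are (a deficit on one side cannot be
-- made up on the other), so canonical parts give a canonical union.
module Submission where

open import Defs
open import Data.Nat using (ℕ; _+_; _≤_)
open import Data.Nat.Properties using (+-mono-≤; +-cancelʳ-≤; +-cancelˡ-≤; ≤-refl; ≤-trans; module ≤-Reasoning)
open import Data.Nat.ListAction using (sum)
open import Data.Nat.ListAction.Properties using (sum-↭)
open import Data.Bool using (Bool; true; false; not; _∧_; _∨_; if_then_else_)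
open import Data.Bool.Properties using (T-≡; T-not-≡; ⇔→≡)
open import Data.Fin using (Fin; splitAt; _↑ˡ_; _↑ʳ_)
open import Data.Fin.Properties using (splitAt-↑ˡ; splitAt-↑ʳ; splitAt⁻¹-↑ˡ; splitAt⁻¹-↑ʳ; ↑ˡ-injective; ↑ʳ-injective)
open import Data.Sum using (inj₁; inj₂)
open import Data.Product using (_×_; _,_; proj₁; proj₂; ∃-syntax; ∃₂)
open import Data.List using (List; []; _∷_; map; _++_; allFin)
open import Data.List.Membership.Propositional using (_∈_; _∉_)
open import Data.List.Membership.Propositional.Properties using (∈-allFin; ∈-map⁺; ∈-map⁻; ∈-++⁺ˡ; ∈-++⁺ʳ; ∈-++⁻)
open import Data.List.Relation.Unary.Any using (here; there)
import Data.List.Relation.Unary.All as All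
import Data.List.Relation.Unary.All.Properties as All
open import Data.List.Relation.Unary.Unique.Propositional using (Unique; []; _∷_)
import Data.List.Relation.Unary.Unique.Propositional.Properties as Unique
open import Data.List.Relation.Binary.Permutation.Propositional
  using (_↭_; refl; prep; swap; trans; ↭-refl; ↭-sym; ↭-trans; ↭⇒↭ₛ)
open import Data.List.Relation.Binary.Permutation.Propositional.Properties
  using (∈-resp-↭; ++⁺ˡ; shift; shifts; map⁺)
import Data.List.Relation.Binary.Permutation.Setoid.Properties as Permutationₛ
open import Function using (_∘_; _⇔_; mk⇔; Equivalence)
open import Relation.Binary.PropositionalEquality
  using (_≡_; _≢_; refl; sym; cong; cong₂; subst; setoid; ≢-sym; module ≡-Reasoning)
  renaming (trans to ≡-trans)
open import Relation.Nullary using (contradiction)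

private
  variable
    A B : Set

countTrue-++ : (p : A → Bool) (xs ys : List A) →
               countTrue p (xs ++ ys) ≡ countTrue p xs + countTrue p ys
countTrue-++ p []       ys = refl
countTrue-++ p (x ∷ xs) ys with p x
... | true  = cong ℕ.suc (countTrue-++ p xs ys)
... | false = countTrue-++ p xs ys

countTrue-map : {p : B → Bool} {q : A → Bool} (f : A → B) → (∀ x → p (f x) ≡ q x) →
                ∀ xs → countTrue p (map f xs) ≡ countTrue q xs
countTrue-map f pf≗q []       = refl
countTrue-map {q = q} f pf≗q (x ∷ xs) rewrite pf≗q x with q x
... | true  = cong ℕ.suc (countTrue-map f pf≗q xs)
... | false = countTrue-map f pf≗q xs

countTrue≡sum : (p : A → Bool) (xs : List A) →
                countTrue p xs ≡ sum (map (λ x → if p x then 1 else 0) xs)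
countTrue≡sum p []       = refl
countTrue≡sum p (x ∷ xs) with p x
... | true  = cong ℕ.suc (countTrue≡sum p xs)
... | false = countTrue≡sum p xs

countTrue-↭ : (p : A → Bool) {xs ys : List A} → xs ↭ ys → countTrue p xs ≡ countTrue p ys
countTrue-↭ p {xs} {ys} σ = begin
  countTrue p xs                                ≡⟨ countTrue≡sum p xs ⟩
  sum (map (λ x → if p x then 1 else 0) xs)     ≡⟨ sum-↭ (map⁺ _ σ) ⟩
  sum (map (λ x → if p x then 1 else 0) ys)     ≡⟨ countTrue≡sum p ys ⟨
  countTrue p ys                                ∎
  where open ≡-Reasoning

Unique-++⁻ : ∀ (xs : List A) {ys} → Unique (xs ++ ys) → Unique xs × Unique ys
Unique-++⁻ []       u            = [] , u
Unique-++⁻ (x ∷ xs) (x∉xs++ys ∷ u) =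
  All.++⁻ˡ xs x∉xs++ys ∷ proj₁ (Unique-++⁻ xs u) , proj₂ (Unique-++⁻ xs u)

Unique-resp-↭ : {xs ys : List A} → xs ↭ ys → Unique xs → Unique ys
Unique-resp-↭ σ = Permutationₛ.AllPairs-resp-↭ (setoid _) ≢-sym
  ((λ { refl x≢y → x≢y }) , (λ { refl x≢y → x≢y })) (↭⇒↭ₛ σ)

endpoints-++ : (xs ys : List (A × A)) → endpoints (xs ++ ys) ≡ endpoints xs ++ endpoints ys
endpoints-++ []             ys = refl
endpoints-++ ((u , v) ∷ xs) ys = cong (λ zs → u ∷ v ∷ zs) (endpoints-++ xs ys)

endpoints-↭ : {xs ys : List (A × A)} → xs ↭ ys → endpoints xs ↭ endpoints ys
endpoints-↭ refl                        = ↭-refl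
endpoints-↭ (prep (u , v) σ)            = prep u (prep v (endpoints-↭ σ))
endpoints-↭ (swap (u , v) (u′ , v′) σ) =
  ↭-trans (++⁺ˡ (u ∷ v ∷ u′ ∷ v′ ∷ []) (endpoints-↭ σ)) (shifts (u ∷ v ∷ []) (u′ ∷ v′ ∷ []))
endpoints-↭ (trans σ τ)                 = ↭-trans (endpoints-↭ σ) (endpoints-↭ τ)

isolated⇔ : (G : Graph) (v : Fin (n G)) → isolated G v ≡ true ⇔ (∀ u → Adj G v u ≡ false)
isolated⇔ G v = mk⇔
  (λ iso u → Equivalence.to T-not-≡
     (All.lookup (All.all⁺ _ (allFin (n G)) (Equivalence.from T-≡ iso)) (∈-allFin u)))
  (λ ¬adj → Equivalence.to T-≡
     (All.all⁻ _ {allFin (n G)} (All.tabulate (λ {u} _ → Equivalence.from T-not-≡ (¬adj u)))))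

module _ (G : Graph) {M M′ : Edges G} (σ : M ↭ M′) where

  isMPD-↭ : ∀ {W} → IsMPD G W M → IsMPD G W M′
  isMPD-↭ (edge , unique , dominate) =
      (λ e → edge (∈-resp-↭ (↭-sym σ) e))
    , Unique-resp-↭ τ unique
    , λ v w v∉ → let u , u∈ , adj = dominate v w (v∉ ∘ ∈-resp-↭ τ) in u , ∈-resp-↭ τ u∈ , adj
    where
    τ : endpoints M ↭ endpoints M′
    τ = endpoints-↭ σ

  matchedNumber-↭ : ∀ R → matchedNumber G R M ≡ matchedNumber G R M′
  matchedNumber-↭ R = countTrue-↭ R (endpoints-↭ σ)

  freeEdges-↭ : ∀ R → freeEdges G R M ≡ freeEdges G R M′
  freeEdges-↭ R = countTrue-↭ _ σ

  isMaxMPD-↭ : ∀ {W R} → IsMaxMPD G W R M → IsMaxMPD G W R M′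
  isMaxMPD-↭ {R = R} (isM , maxM) = isMPD-↭ isM , λ M″ isM″ → subst (_ ≤_) (matchedNumber-↭ R) (maxM M″ isM″)

≤-summands : ∀ {a b c d : ℕ} → c ≤ a → d ≤ b → a + b ≤ c + d → a ≤ c × b ≤ d
≤-summands {a} {b} {c} {d} c≤a d≤b a+b≤c+d =
    +-cancelʳ-≤ b a c (≤-trans a+b≤c+d (+-mono-≤ (≤-refl {c}) d≤b))
  , +-cancelˡ-≤ c b d (≤-trans (+-mono-≤ c≤a (≤-refl {b})) a+b≤c+d)

isMaxMPD-≥ : ∀ G {W R C M} → IsMaxMPD G W R C → IsMPD G W M →
             matchedNumber G R C ≤ matchedNumber G R M → IsMaxMPD G W R M
isMaxMPD-≥ G (_ , maxC) isM C≤M = isM , λ M′ isM′ → ≤-trans (maxC M′ isM′) C≤M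

data SplitView (m k : ℕ) : Fin (m + k) → Set where
  left  : (x : Fin m) → SplitView m k (x ↑ˡ k)
  right : (y : Fin k) → SplitView m k (m ↑ʳ y)

splitView : ∀ m k (v : Fin (m + k)) → SplitView m k v
splitView m k v with splitAt m v in eq
... | inj₁ x = subst (SplitView m k) (splitAt⁻¹-↑ˡ eq) (left x)
... | inj₂ y = subst (SplitView m k) (splitAt⁻¹-↑ʳ eq) (right y)

↑ˡ≢↑ʳ : ∀ {m k} (x : Fin m) (y : Fin k) → x ↑ˡ k ≢ m ↑ʳ y
↑ˡ≢↑ʳ {m} {k} x y eq with ≡-trans (sym (splitAt-↑ˡ m x k)) (≡-trans (cong (splitAt m) eq) (splitAt-↑ʳ m k y))
... | ()

module DisjointUnion (GL GR : Graph) where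

  m k : ℕ
  m = n GL
  k = n GR

  G : Graph
  G = GL ⊕ GR

  adj-↑ˡ-↑ˡ : ∀ x y → Adj G (x ↑ˡ k) (y ↑ˡ k) ≡ Adj GL x y
  adj-↑ˡ-↑ˡ x y rewrite splitAt-↑ˡ m x k | splitAt-↑ˡ m y k = refl

  adj-↑ʳ-↑ʳ : ∀ x y → Adj G (m ↑ʳ x) (m ↑ʳ y) ≡ Adj GR x y
  adj-↑ʳ-↑ʳ x y rewrite splitAt-↑ʳ m k x | splitAt-↑ʳ m k y = refl

  adj-↑ˡ-↑ʳ : ∀ x y → Adj G (x ↑ˡ k) (m ↑ʳ y) ≡ false
  adj-↑ˡ-↑ʳ x y rewrite splitAt-↑ˡ m x k | splitAt-↑ʳ m k y = refl

  adj-↑ʳ-↑ˡ : ∀ x y → Adj G (m ↑ʳ x) (y ↑ˡ k) ≡ false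
  adj-↑ʳ-↑ˡ x y rewrite splitAt-↑ʳ m k x | splitAt-↑ˡ m y k = refl

  neighbour-↑ˡ : ∀ {x u} → Adj G (x ↑ˡ k) u ≡ true → ∃₂ λ y (_ : u ≡ y ↑ˡ k) → Adj GL x y ≡ true
  neighbour-↑ˡ {x} {u} adj with splitView m k u
  ... | left y  = y , refl , ≡-trans (sym (adj-↑ˡ-↑ˡ x y)) adj
  ... | right y = contradiction (≡-trans (sym adj) (adj-↑ˡ-↑ʳ x y)) λ ()

  neighbour-↑ʳ : ∀ {x u} → Adj G (m ↑ʳ x) u ≡ true → ∃₂ λ y (_ : u ≡ m ↑ʳ y) → Adj GR x y ≡ true
  neighbour-↑ʳ {x} {u} adj with splitView m k u
  ... | left y  = contradiction (≡-trans (sym adj) (adj-↑ʳ-↑ˡ x y)) λ ()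
  ... | right y = y , refl , ≡-trans (sym (adj-↑ʳ-↑ʳ x y)) adj

  isolated-↑ˡ : ∀ x → isolated G (x ↑ˡ k) ≡ isolated GL x
  isolated-↑ˡ x = ⇔→≡ (mk⇔
    (λ iso → Equivalence.from (isolated⇔ GL x) λ y →
      ≡-trans (sym (adj-↑ˡ-↑ˡ x y)) (Equivalence.to (isolated⇔ G _) iso (y ↑ˡ k)))
    (λ iso → Equivalence.from (isolated⇔ G _) λ u → nonadjacent iso u (splitView m k u)))
    where
    nonadjacent : isolated GL x ≡ true → ∀ u → SplitView m k u → Adj G (x ↑ˡ k) u ≡ false
    nonadjacent iso _ (left y)  = ≡-trans (adj-↑ˡ-↑ˡ x y) (Equivalence.to (isolated⇔ GL x) iso y)
    nonadjacent iso _ (right y) = adj-↑ˡ-↑ʳ x y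

  isolated-↑ʳ : ∀ x → isolated G (m ↑ʳ x) ≡ isolated GR x
  isolated-↑ʳ x = ⇔→≡ (mk⇔
    (λ iso → Equivalence.from (isolated⇔ GR x) λ y →
      ≡-trans (sym (adj-↑ʳ-↑ʳ x y)) (Equivalence.to (isolated⇔ G _) iso (m ↑ʳ y)))
    (λ iso → Equivalence.from (isolated⇔ G _) λ u → nonadjacent iso u (splitView m k u)))
    where
    nonadjacent : isolated GR x ≡ true → ∀ u → SplitView m k u → Adj G (m ↑ʳ x) u ≡ false
    nonadjacent iso _ (left y)  = adj-↑ʳ-↑ˡ x y
    nonadjacent iso _ (right y) = ≡-trans (adj-↑ʳ-↑ʳ x y) (Equivalence.to (isolated⇔ GR x) iso y)

  nonIsolated-↑ˡ : ∀ x → nonIsolated G (x ↑ˡ k) ≡ nonIsolated GL x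
  nonIsolated-↑ˡ x = cong not (isolated-↑ˡ x)

  nonIsolated-↑ʳ : ∀ x → nonIsolated G (m ↑ʳ x) ≡ nonIsolated GR x
  nonIsolated-↑ʳ x = cong not (isolated-↑ʳ x)

  _⊕ᴱ_ : Edges GL → Edges GR → Edges G
  A ⊕ᴱ B = liftL GL GR A ++ liftR GL GR B

  endpoints-liftL : ∀ A → endpoints (liftL GL GR A) ≡ map (_↑ˡ k) (endpoints A)
  endpoints-liftL []            = refl
  endpoints-liftL ((x , y) ∷ A) = cong (λ zs → (x ↑ˡ k) ∷ (y ↑ˡ k) ∷ zs) (endpoints-liftL A)

  endpoints-liftR : ∀ B → endpoints (liftR GL GR B) ≡ map (m ↑ʳ_) (endpoints B)
  endpoints-liftR []            = refl
  endpoints-liftR ((x , y) ∷ B) = cong (λ zs → (m ↑ʳ x) ∷ (m ↑ʳ y) ∷ zs) (endpoints-liftR B)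

  endpoints-⊕ᴱ : ∀ A B → endpoints (A ⊕ᴱ B) ≡ map (_↑ˡ k) (endpoints A) ++ map (m ↑ʳ_) (endpoints B)
  endpoints-⊕ᴱ A B = ≡-trans (endpoints-++ (liftL GL GR A) (liftR GL GR B))
                             (cong₂ _++_ (endpoints-liftL A) (endpoints-liftR B))

  module _ {A : Edges GL} {B : Edges GR} where

    ∈-endpoints-↑ˡ⁺ : ∀ {x} → x ∈ endpoints A → x ↑ˡ k ∈ endpoints (A ⊕ᴱ B)
    ∈-endpoints-↑ˡ⁺ x∈ = subst (_ ∈_) (sym (endpoints-⊕ᴱ A B)) (∈-++⁺ˡ (∈-map⁺ (_↑ˡ k) x∈))

    ∈-endpoints-↑ʳ⁺ : ∀ {x} → x ∈ endpoints B → m ↑ʳ x ∈ endpoints (A ⊕ᴱ B)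
    ∈-endpoints-↑ʳ⁺ x∈ = subst (_ ∈_) (sym (endpoints-⊕ᴱ A B)) (∈-++⁺ʳ _ (∈-map⁺ (m ↑ʳ_) x∈))

    ∈-endpoints-↑ˡ⁻ : ∀ {x} → x ↑ˡ k ∈ endpoints (A ⊕ᴱ B) → x ∈ endpoints A
    ∈-endpoints-↑ˡ⁻ {x} x∈ with ∈-++⁻ (map (_↑ˡ k) (endpoints A)) (subst (_ ∈_) (endpoints-⊕ᴱ A B) x∈)
    ... | inj₁ x∈A = let y , y∈ , eq = ∈-map⁻ (_↑ˡ k) x∈A in subst (_∈ _) (sym (↑ˡ-injective k x y eq)) y∈
    ... | inj₂ x∈B = let y , _ , eq = ∈-map⁻ (m ↑ʳ_) x∈B in contradiction eq (↑ˡ≢↑ʳ x y)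

    ∈-endpoints-↑ʳ⁻ : ∀ {x} → m ↑ʳ x ∈ endpoints (A ⊕ᴱ B) → x ∈ endpoints B
    ∈-endpoints-↑ʳ⁻ {x} x∈ with ∈-++⁻ (map (_↑ˡ k) (endpoints A)) (subst (_ ∈_) (endpoints-⊕ᴱ A B) x∈)
    ... | inj₁ x∈A = let y , _ , eq = ∈-map⁻ (_↑ˡ k) x∈A in contradiction (sym eq) (↑ˡ≢↑ʳ y x)
    ... | inj₂ x∈B = let y , y∈ , eq = ∈-map⁻ (m ↑ʳ_) x∈B in subst (_∈ _) (sym (↑ʳ-injective m x y eq)) y∈

    isMPD-⊕ᴱ⁺ : IsMPD GL (nonIsolated GL) A → IsMPD GR (nonIsolated GR) B →
                IsMPD G (nonIsolated G) (A ⊕ᴱ B)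
    isMPD-⊕ᴱ⁺ (edgeL , uniqueL , dominateL) (edgeR , uniqueR , dominateR) = edge , unique , dominate
      where
      edge : ∀ {u v} → (u , v) ∈ A ⊕ᴱ B →
             (Adj G u v ≡ true) × (nonIsolated G u ≡ true) × (nonIsolated G v ≡ true)
      edge uv∈ with ∈-++⁻ (liftL GL GR A) uv∈
      ... | inj₁ uv∈A with ∈-map⁻ _ uv∈A
      ...   | (x , y) , xy∈ , refl = let adj , wx , wy = edgeL xy∈ in
        ≡-trans (adj-↑ˡ-↑ˡ x y) adj , ≡-trans (nonIsolated-↑ˡ x) wx , ≡-trans (nonIsolated-↑ˡ y) wy
      edge uv∈ | inj₂ uv∈B with ∈-map⁻ _ uv∈B
      ...   | (x , y) , xy∈ , refl = let adj , wx , wy = edgeR xy∈ in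
        ≡-trans (adj-↑ʳ-↑ʳ x y) adj , ≡-trans (nonIsolated-↑ʳ x) wx , ≡-trans (nonIsolated-↑ʳ y) wy

      unique : Unique (endpoints (A ⊕ᴱ B))
      unique = subst Unique (sym (endpoints-⊕ᴱ A B))
        (Unique.++⁺ (Unique.map⁺ (↑ˡ-injective k _ _) uniqueL) (Unique.map⁺ (↑ʳ-injective m _ _) uniqueR)
          λ (v∈A , v∈B) → let x , _ , eqˡ = ∈-map⁻ (_↑ˡ k) v∈A ; y , _ , eqʳ = ∈-map⁻ (m ↑ʳ_) v∈B
                          in ↑ˡ≢↑ʳ x y (≡-trans (sym eqˡ) eqʳ))

      dominate′ : ∀ v → SplitView m k v → nonIsolated G v ≡ true → v ∉ endpoints (A ⊕ᴱ B) →
                  ∃[ u ] (u ∈ endpoints (A ⊕ᴱ B) × Adj G v u ≡ true)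
      dominate′ _ (left x) w x∉ =
        let y , y∈ , adj = dominateL x (≡-trans (sym (nonIsolated-↑ˡ x)) w) (x∉ ∘ ∈-endpoints-↑ˡ⁺)
        in y ↑ˡ k , ∈-endpoints-↑ˡ⁺ y∈ , ≡-trans (adj-↑ˡ-↑ˡ x y) adj
      dominate′ _ (right x) w x∉ =
        let y , y∈ , adj = dominateR x (≡-trans (sym (nonIsolated-↑ʳ x)) w) (x∉ ∘ ∈-endpoints-↑ʳ⁺)
        in m ↑ʳ y , ∈-endpoints-↑ʳ⁺ y∈ , ≡-trans (adj-↑ʳ-↑ʳ x y) adj

      dominate : ∀ v → nonIsolated G v ≡ true → v ∉ endpoints (A ⊕ᴱ B) →
                 ∃[ u ] (u ∈ endpoints (A ⊕ᴱ B) × Adj G v u ≡ true)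
      dominate v = dominate′ v (splitView m k v)

    isMPD-⊕ᴱ⁻ˡ : IsMPD G (nonIsolated G) (A ⊕ᴱ B) → IsMPD GL (nonIsolated GL) A
    isMPD-⊕ᴱ⁻ˡ (edge , unique , dominate) = edgeL , uniqueL , dominateL
      where
      edgeL : ∀ {x y} → (x , y) ∈ A →
              (Adj GL x y ≡ true) × (nonIsolated GL x ≡ true) × (nonIsolated GL y ≡ true)
      edgeL {x} {y} xy∈ = let adj , wx , wy = edge (∈-++⁺ˡ (∈-map⁺ _ xy∈)) in
        ≡-trans (sym (adj-↑ˡ-↑ˡ x y)) adj , ≡-trans (sym (nonIsolated-↑ˡ x)) wx , ≡-trans (sym (nonIsolated-↑ˡ y)) wy

      uniqueL : Unique (endpoints A)
      uniqueL = Unique.map⁻ (proj₁ (Unique-++⁻ _ (subst Unique (endpoints-⊕ᴱ A B) unique)))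

      dominateL : ∀ x → nonIsolated GL x ≡ true → x ∉ endpoints A →
                  ∃[ y ] (y ∈ endpoints A × Adj GL x y ≡ true)
      dominateL x w x∉ with dominate (x ↑ˡ k) (≡-trans (nonIsolated-↑ˡ x) w) (x∉ ∘ ∈-endpoints-↑ˡ⁻)
      ... | u , u∈ , adj with neighbour-↑ˡ adj
      ...   | y , refl , adjL = y , ∈-endpoints-↑ˡ⁻ u∈ , adjL

    isMPD-⊕ᴱ⁻ʳ : IsMPD G (nonIsolated G) (A ⊕ᴱ B) → IsMPD GR (nonIsolated GR) B
    isMPD-⊕ᴱ⁻ʳ (edge , unique , dominate) = edgeR , uniqueR , dominateR
      where
      edgeR : ∀ {x y} → (x , y) ∈ B →
              (Adj GR x y ≡ true) × (nonIsolated GR x ≡ true) × (nonIsolated GR y ≡ true)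
      edgeR {x} {y} xy∈ = let adj , wx , wy = edge (∈-++⁺ʳ _ (∈-map⁺ _ xy∈)) in
        ≡-trans (sym (adj-↑ʳ-↑ʳ x y)) adj , ≡-trans (sym (nonIsolated-↑ʳ x)) wx , ≡-trans (sym (nonIsolated-↑ʳ y)) wy

      uniqueR : Unique (endpoints B)
      uniqueR = Unique.map⁻ (proj₂ (Unique-++⁻ _ (subst Unique (endpoints-⊕ᴱ A B) unique)))

      dominateR : ∀ x → nonIsolated GR x ≡ true → x ∉ endpoints B →
                  ∃[ y ] (y ∈ endpoints B × Adj GR x y ≡ true)
      dominateR x w x∉ with dominate (m ↑ʳ x) (≡-trans (nonIsolated-↑ʳ x) w) (x∉ ∘ ∈-endpoints-↑ʳ⁻)
      ... | u , u∈ , adj with neighbour-↑ʳ adj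
      ...   | y , refl , adjR = y , ∈-endpoints-↑ʳ⁻ u∈ , adjR

  ⊕ᴱ-split : (M : Edges G) → (∀ {u v} → (u , v) ∈ M → Adj G u v ≡ true) →
             ∃₂ λ A B → M ↭ A ⊕ᴱ B
  ⊕ᴱ-split []            _   = [] , [] , ↭-refl
  ⊕ᴱ-split ((u , v) ∷ M) adj with ⊕ᴱ-split M (adj ∘ there) | splitView m k u
  ... | A , B , σ | left x with neighbour-↑ˡ (adj (here refl))
  ...   | y , refl , _ = (x , y) ∷ A , B , prep _ σ
  ⊕ᴱ-split ((u , v) ∷ M) adj | A , B , σ | right x with neighbour-↑ʳ (adj (here refl))
  ...   | y , refl , _ = A , (x , y) ∷ B , ↭-trans (prep _ σ) (↭-sym (shift _ (liftL GL GR A) (liftR GL GR B)))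

  decompose : ∀ {M} → IsMPD G (nonIsolated G) M →
              ∃₂ λ A B → IsMPD GL (nonIsolated GL) A × IsMPD GR (nonIsolated GR) B × M ↭ A ⊕ᴱ B
  decompose {M} isM with ⊕ᴱ-split M (λ uv∈ → proj₁ (proj₁ isM uv∈))
  ... | A , B , σ = A , B , isMPD-⊕ᴱ⁻ˡ isA⊕B , isMPD-⊕ᴱ⁻ʳ isA⊕B , σ
    where
    isA⊕B : IsMPD G (nonIsolated G) (A ⊕ᴱ B)
    isA⊕B = isMPD-↭ G σ isM

  module _ (R : Fin (m + k) → Bool) where

    RG : Fin (m + k) → Bool
    RG = restrictNI G R

    RL : Fin m → Bool
    RL = restrictNI GL (λ i → R (i ↑ˡ k))

    RR : Fin k → Bool
    RR = restrictNI GR (λ j → R (m ↑ʳ j))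

    restrictNI-↑ˡ : ∀ x → RG (x ↑ˡ k) ≡ RL x
    restrictNI-↑ˡ x = cong (R (x ↑ˡ k) ∧_) (nonIsolated-↑ˡ x)

    restrictNI-↑ʳ : ∀ x → RG (m ↑ʳ x) ≡ RR x
    restrictNI-↑ʳ x = cong (R (m ↑ʳ x) ∧_) (nonIsolated-↑ʳ x)

    matchedNumber-⊕ᴱ : ∀ A B → matchedNumber G RG (A ⊕ᴱ B) ≡ matchedNumber GL RL A + matchedNumber GR RR B
    matchedNumber-⊕ᴱ A B = begin
      countTrue RG (endpoints (A ⊕ᴱ B))
        ≡⟨ cong (countTrue RG) (endpoints-⊕ᴱ A B) ⟩
      countTrue RG (map (_↑ˡ k) (endpoints A) ++ map (m ↑ʳ_) (endpoints B))
        ≡⟨ countTrue-++ RG (map (_↑ˡ k) (endpoints A)) _ ⟩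
      countTrue RG (map (_↑ˡ k) (endpoints A)) + countTrue RG (map (m ↑ʳ_) (endpoints B))
        ≡⟨ cong₂ _+_ (countTrue-map _ restrictNI-↑ˡ (endpoints A)) (countTrue-map _ restrictNI-↑ʳ (endpoints B)) ⟩
      countTrue RL (endpoints A) + countTrue RR (endpoints B)
        ∎
      where open ≡-Reasoning

    freeEdges-⊕ᴱ : ∀ A B → freeEdges G RG (A ⊕ᴱ B) ≡ freeEdges GL RL A + freeEdges GR RR B
    freeEdges-⊕ᴱ A B = ≡-trans (countTrue-++ _ (liftL GL GR A) (liftR GL GR B)) (cong₂ _+_
      (countTrue-map _ (λ (x , y) → cong₂ (λ s t → not (s ∨ t)) (restrictNI-↑ˡ x) (restrictNI-↑ˡ y)) A)
      (countTrue-map _ (λ (x , y) → cong₂ (λ s t → not (s ∨ t)) (restrictNI-↑ʳ x) (restrictNI-↑ʳ y)) B))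

    module _ {CL : Edges GL} {CR : Edges GR}
             (maxCL : IsMaxMPD GL (nonIsolated GL) RL CL) (maxCR : IsMaxMPD GR (nonIsolated GR) RR CR) where

      ⊕ᴱ-maximum : IsMaxMPD G (nonIsolated G) RG (CL ⊕ᴱ CR)
      ⊕ᴱ-maximum = isMPD-⊕ᴱ⁺ (proj₁ maxCL) (proj₁ maxCR) , maximal
        where
        maximal : ∀ M → IsMPD G (nonIsolated G) M → matchedNumber G RG M ≤ matchedNumber G RG (CL ⊕ᴱ CR)
        maximal M isM with decompose isM
        ... | A , B , isA , isB , σ = begin
          matchedNumber G RG M                                  ≡⟨ matchedNumber-↭ G σ RG ⟩
          matchedNumber G RG (A ⊕ᴱ B)                           ≡⟨ matchedNumber-⊕ᴱ A B ⟩
          matchedNumber GL RL A + matchedNumber GR RR B         ≤⟨ +-mono-≤ (proj₂ maxCL A isA) (proj₂ maxCR B isB) ⟩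
          matchedNumber GL RL CL + matchedNumber GR RR CR       ≡⟨ matchedNumber-⊕ᴱ CL CR ⟨
          matchedNumber G RG (CL ⊕ᴱ CR)                         ∎
          where open ≤-Reasoning

      ⊕ᴱ-maximum⁻ : ∀ {A B} → IsMPD GL (nonIsolated GL) A → IsMPD GR (nonIsolated GR) B →
                    IsMaxMPD G (nonIsolated G) RG (A ⊕ᴱ B) →
                    IsMaxMPD GL (nonIsolated GL) RL A × IsMaxMPD GR (nonIsolated GR) RR B
      ⊕ᴱ-maximum⁻ {A} {B} isA isB (_ , maxA⊕B) =
        let CL≤A , CR≤B = ≤-summands (proj₂ maxCL A isA) (proj₂ maxCR B isB) C≤A+B
        in isMaxMPD-≥ GL maxCL isA CL≤A , isMaxMPD-≥ GR maxCR isB CR≤B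
        where
        C≤A+B : matchedNumber GL RL CL + matchedNumber GR RR CR ≤ matchedNumber GL RL A + matchedNumber GR RR B
        C≤A+B = begin
          matchedNumber GL RL CL + matchedNumber GR RR CR       ≡⟨ matchedNumber-⊕ᴱ CL CR ⟨
          matchedNumber G RG (CL ⊕ᴱ CR)                         ≤⟨ maxA⊕B (CL ⊕ᴱ CR) (proj₁ ⊕ᴱ-maximum) ⟩
          matchedNumber G RG (A ⊕ᴱ B)                           ≡⟨ matchedNumber-⊕ᴱ A B ⟩
          matchedNumber GL RL A + matchedNumber GR RR B         ∎
          where open ≤-Reasoning

    ⊕ᴱ-canonical : ∀ {CL CR} → IsCanonicalMPD GL (nonIsolated GL) RL CL → IsCanonicalMPD GR (nonIsolated GR) RR CR →
                   IsCanonicalMPD G (nonIsolated G) RG (CL ⊕ᴱ CR)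
    ⊕ᴱ-canonical {CL} {CR} (maxCL , fewestCL) (maxCR , fewestCR) = ⊕ᴱ-maximum maxCL maxCR , fewest
      where
      fewest : ∀ M → IsMaxMPD G (nonIsolated G) RG M → freeEdges G RG (CL ⊕ᴱ CR) ≤ freeEdges G RG M
      fewest M (isM , maxM) with decompose isM
      ... | A , B , isA , isB , σ = begin
        freeEdges G RG (CL ⊕ᴱ CR)                   ≡⟨ freeEdges-⊕ᴱ CL CR ⟩
        freeEdges GL RL CL + freeEdges GR RR CR     ≤⟨ +-mono-≤ (fewestCL A (proj₁ maxA×maxB)) (fewestCR B (proj₂ maxA×maxB)) ⟩
        freeEdges GL RL A + freeEdges GR RR B       ≡⟨ freeEdges-⊕ᴱ A B ⟨
        freeEdges G RG (A ⊕ᴱ B)                     ≡⟨ freeEdges-↭ G σ RG ⟨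
        freeEdges G RG M                            ∎
        where
        open ≤-Reasoning
        maxA×maxB : IsMaxMPD GL (nonIsolated GL) RL A × IsMaxMPD GR (nonIsolated GR) RR B
        maxA×maxB = ⊕ᴱ-maximum⁻ maxCL maxCR isA isB (isMaxMPD-↭ G σ (isM , maxM))

lemma4 : (GL GR : Graph) → IsCograph GL → IsCograph GR → IsCograph (GL ⊕ GR) →
         (R : Fin (n (GL ⊕ GR)) → Bool) →
         (CL : Edges GL) → (CR : Edges GR) →
         IsCanonicalMPD GL (nonIsolated GL) (restrictNI GL (λ i → R (i ↑ˡ n GR))) CL →
         IsCanonicalMPD GR (nonIsolated GR) (restrictNI GR (λ j → R (n GL ↑ʳ j))) CR →
         ((∀ i → isolated (GL ⊕ GR) (i ↑ˡ n GR) ≡ isolated GL i) ×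
          (∀ j → isolated (GL ⊕ GR) (n GL ↑ʳ j) ≡ isolated GR j)) ×
         IsCanonicalMPD (GL ⊕ GR) (nonIsolated (GL ⊕ GR)) (restrictNI (GL ⊕ GR) R)
           (liftL GL GR CL ++ liftR GL GR CR)
lemma4 GL GR _ _ _ R _ _ canonicalL canonicalR =
  (isolated-↑ˡ , isolated-↑ʳ) , ⊕ᴱ-canonical R canonicalL canonicalR
  where open DisjointUnion GL GR
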